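{- For any cut-free derivation $f$ of $S \mid \Gamma \vdash C$, we have $\mathrm{emb}_{\mathsf L}(\mathrm{focus}\, f) \circeq f$.
   Context: Fix a set $\mathrm{Var}$ of atoms. Formulae: atoms $X \in \mathrm{Var}$, $\mathsf{I}$, and $A \otimes B$. A context is a finite list of formulae; a stoup $S$ is either empty ($-$) or a single formula; a stoup $T$ is irreducible if $T = -$ or $T$ is an atom. Cut-free sequent calculus: sequents $S \mid \Gamma \vdash C$ derived by (ax) $A \mid\ \vdash A$; (pass) from $A \mid \Gamma \vdash C$ infer $- \mid A, \Gamma \vdash C$; ($\mathsf I$L) from $- \mid \Gamma \vdash C$ infer $\mathsf I \mid \Gamma \vdash C$; ($\mathsf I$R) $- \mid\ \vdash \mathsf I$; ($\otimes$L) from $A \mid B, \Gamma \vdash C$ infer $A \otimes B \mid \Gamma \vdash C$; ($\otimes$R) from $S \mid \Gamma \vdash A$ and $- \mid \Delta \vdash B$ infer $S \mid \Gamma, \Delta \vdash A \otimes B$. The relation $\circeq$ is the least congruence on cut-free derivations (w.r.t. all rules) containing: $\mathrm{ax}_{\mathsf I} \circeq \mathsf{I}\mathrm{L}(\mathsf I\mathrm R)$; $\mathrm{ax}_{A \otimes B} \circeq \otimes\mathrm L(\otimes\mathrm R(\mathrm{ax}_A, \mathrm{pass}(\mathrm{ax}_B)))$; $\otimes\mathrm R(\mathrm{pass}\, f, g) \circeq \mathrm{pass}(\otimes\mathrm R(f, g))$; $\otimes\mathrm R(\mathsf I\mathrm L\, f, g) \circeq \mathsf I\mathrm L(\otimes\mathrm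 R(f, g))$; $\otimes\mathrm R(\otimes\mathrm L\, f, g) \circeq \otimes\mathrm L(\otimes\mathrm R(f, g))$. Focused calculus: sequents $S \mid \Gamma \vdash_{\mathsf L} C$ and $T \mid \Gamma \vdash_{\mathsf R} C$ ($T$ irreducible), derived by: (pass) from $A \mid \Gamma \vdash_{\mathsf L} C$ infer $- \mid A, \Gamma \vdash_{\mathsf L} C$; (switch) from $T \mid \Gamma \vdash_{\mathsf R} C$ infer $T \mid \Gamma \vdash_{\mathsf L} C$; (ax$_X$) $X \mid\ \vdash_{\mathsf R} X$ for atoms $X$; ($\mathsf I$L) from $- \mid \Gamma \vdash_{\mathsf L} C$ infer $\mathsf I \mid \Gamma \vdash_{\mathsf L} C$; ($\mathsf I$R$_{\mathsf R}$) $- \mid\ \vdash_{\mathsf R} \mathsf I$; ($\otimes$L) from $A \mid B, \Gamma \vdash_{\mathsf L} C$ infer $A \otimes B \mid \Gamma \vdash_{\mathsf L} C$; ($\otimes$R$_{\mathsf R}$) from $T \mid \Gamma \vdash_{\mathsf R} A$ and $- \mid \Delta \vdash_{\mathsf L} B$ infer $T \mid \Gamma, \Delta \vdash_{\mathsf R} A \otimes B$. $\mathrm{emb}_{\mathsf L}$ maps a focused derivation to a cut-free derivation of the same sequent (phase erased) by deleting every switch step and replacing each focused rule by the unfocused rule of the same name (ax$_X$ by ax, $\mathsf I$R$_{\mathsf R}$ by $\mathsf I$R, $\otimes$R$_{\mathsf R}$ by $\otimes$R). $\mathrm{focus}$ maps cut-free derivations of $S \mid \Gamma \vdash C$ to focused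 derivations of $S \mid \Gamma \vdash_{\mathsf L} C$: $\mathrm{focus}(\mathrm{pass}\, f) = \mathrm{pass}(\mathrm{focus}\, f)$, $\mathrm{focus}(\mathsf I\mathrm L\, f) = \mathsf I\mathrm L(\mathrm{focus}\, f)$, $\mathrm{focus}(\otimes\mathrm L\, f) = \otimes\mathrm L(\mathrm{focus}\, f)$, $\mathrm{focus}(\mathsf I\mathrm R) = \mathrm{switch}(\mathsf I\mathrm R_{\mathsf R})$, $\mathrm{focus}(\otimes\mathrm R(f, g)) = \otimes\mathrm R_{\mathsf L}(\mathrm{focus}\, f, \mathrm{focus}\, g)$, $\mathrm{focus}(\mathrm{ax}_A) = \mathrm{ax}_{\mathsf L, A}$, where $\otimes\mathrm R_{\mathsf L}$ is defined by recursion on its first argument: $\otimes\mathrm R_{\mathsf L}(\mathrm{pass}\, f, g) = \mathrm{pass}(\otimes\mathrm R_{\mathsf L}(f, g))$, $\otimes\mathrm R_{\mathsf L}(\mathsf I\mathrm L\, f, g) = \mathsf I\mathrm L(\otimes\mathrm R_{\mathsf L}(f, g))$, $\otimes\mathrm R_{\mathsf L}(\otimes\mathrm L\, f, g) = \otimes\mathrm L(\otimes\mathrm R_{\mathsf L}(f, g))$, $\otimes\mathrm R_{\mathsf L}(\mathrm{switch}\, f, g) = \mathrm{switch}(\otimes\mathrm R_{\mathsf R}(f, g))$; and $\mathrm{ax}_{\mathsf L, X} = \mathrm{switch}(\mathrm{ax}_X)$, $\mathrm{ax}_{\mathsf L, \mathsf I} = \mathsf I\mathrm L(\mathrm{switch}(\mathsf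 I\mathrm R_{\mathsf R}))$, $\mathrm{ax}_{\mathsf L, A \otimes B} = \otimes\mathrm L(\otimes\mathrm R_{\mathsf L}(\mathrm{ax}_{\mathsf L, A}, \mathrm{pass}(\mathrm{ax}_{\mathsf L, B})))$. -}

module Defs where

open import Data.List using (List; []; _∷_; _++_)
open import Data.Maybe using (Maybe; nothing; just)
open import Relation.Binary.PropositionalEquality using (_≡_; refl)

module _ {Var : Set} where

  data Fma : Set where
    ` : Var → Fma
    I : Fma
    _⊗_ : Fma → Fma → Fma

  infixl 22 _⊗_

  Stp : Set
  Stp = Maybe Fma

  Cxt : Set
  Cxt = List Fma

  data Irr : Set where
    -irr : Irr
    atIrr : Var → Irr

  irr : Irr → Stp
  irr -irr = nothing
  irr (atIrr X) = just (` X)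

  infix 15 _∣_⊢_ _∣_⊢L_ _∣_⊢R_

  data _∣_⊢_ : Stp → Cxt → Fma → Set where
    ax : {A : Fma} → just A ∣ [] ⊢ A
    pass : {Γ : Cxt} {A C : Fma} → just A ∣ Γ ⊢ C → nothing ∣ A ∷ Γ ⊢ C
    IL : {Γ : Cxt} {C : Fma} → nothing ∣ Γ ⊢ C → just I ∣ Γ ⊢ C
    IR : nothing ∣ [] ⊢ I
    ⊗L : {Γ : Cxt} {A B C : Fma} → just A ∣ B ∷ Γ ⊢ C → just (A ⊗ B) ∣ Γ ⊢ C
    ⊗R : {S : Stp} {Γ Δ : Cxt} {A B : Fma} →
         S ∣ Γ ⊢ A → nothing ∣ Δ ⊢ B → S ∣ Γ ++ Δ ⊢ A ⊗ B

  infix 5 _≗_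

  data _≗_ : {S : Stp} {Γ : Cxt} {C : Fma} → S ∣ Γ ⊢ C → S ∣ Γ ⊢ C → Set where
    refl≗ : ∀ {S Γ C} {f : S ∣ Γ ⊢ C} → f ≗ f
    ~_ : ∀ {S Γ C} {f g : S ∣ Γ ⊢ C} → f ≗ g → g ≗ f
    _∙_ : ∀ {S Γ C} {f g h : S ∣ Γ ⊢ C} → f ≗ g → g ≗ h → f ≗ h
    pass : ∀ {Γ A C} {f g : just A ∣ Γ ⊢ C} → f ≗ g → pass f ≗ pass g
    IL : ∀ {Γ C} {f g : nothing ∣ Γ ⊢ C} → f ≗ g → IL f ≗ IL g
    ⊗L : ∀ {Γ A B C} {f g : just A ∣ B ∷ Γ ⊢ C} → f ≗ g → ⊗L f ≗ ⊗L g
    ⊗R : ∀ {S Γ Δ A B} {f g : S ∣ Γ ⊢ A} {f' g' : nothing ∣ Δ ⊢ B} →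
         f ≗ g → f' ≗ g' → ⊗R f f' ≗ ⊗R g g'
    axI : ax ≗ IL IR
    ax⊗ : ∀ {A B} → ax {A ⊗ B} ≗ ⊗L (⊗R ax (pass ax))
    ⊗Rpass : ∀ {Γ Δ A A' B} {f : just A' ∣ Γ ⊢ A} {g : nothing ∣ Δ ⊢ B} →
             ⊗R (pass f) g ≗ pass (⊗R f g)
    ⊗RIL : ∀ {Γ Δ A B} {f : nothing ∣ Γ ⊢ A} {g : nothing ∣ Δ ⊢ B} →
           ⊗R (IL f) g ≗ IL (⊗R f g)
    ⊗R⊗L : ∀ {Γ Δ A A' B' B} {f : just A' ∣ B' ∷ Γ ⊢ A} {g : nothing ∣ Δ ⊢ B} →
           ⊗R (⊗L f) g ≗ ⊗L (⊗R f g)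

  data _∣_⊢L_ : Stp → Cxt → Fma → Set
  data _∣_⊢R_ : Irr → Cxt → Fma → Set

  data _∣_⊢L_ where
    pass : {Γ : Cxt} {A C : Fma} → just A ∣ Γ ⊢L C → nothing ∣ A ∷ Γ ⊢L C
    switch : {T : Irr} {Γ : Cxt} {C : Fma} → T ∣ Γ ⊢R C → irr T ∣ Γ ⊢L C
    IL : {Γ : Cxt} {C : Fma} → nothing ∣ Γ ⊢L C → just I ∣ Γ ⊢L C
    ⊗L : {Γ : Cxt} {A B C : Fma} → just A ∣ B ∷ Γ ⊢L C → just (A ⊗ B) ∣ Γ ⊢L C

  data _∣_⊢R_ where
    ax : {X : Var} → atIrr X ∣ [] ⊢R ` X
    IR : -irr ∣ [] ⊢R I
    ⊗R : {T : Irr} {Γ Δ : Cxt} {A B : Fma} →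
         T ∣ Γ ⊢R A → nothing ∣ Δ ⊢L B → T ∣ Γ ++ Δ ⊢R A ⊗ B

  embL : {S : Stp} {Γ : Cxt} {C : Fma} → S ∣ Γ ⊢L C → S ∣ Γ ⊢ C
  embR : {T : Irr} {Γ : Cxt} {C : Fma} → T ∣ Γ ⊢R C → irr T ∣ Γ ⊢ C
  embL (pass f) = pass (embL f)
  embL (switch f) = embR f
  embL (IL f) = IL (embL f)
  embL (⊗L f) = ⊗L (embL f)
  embR ax = ax
  embR IR = IR
  embR (⊗R f g) = ⊗R (embR f) (embL g)

  ⊗RL : {S : Stp} {Γ Δ : Cxt} {A B : Fma} →
        S ∣ Γ ⊢L A → nothing ∣ Δ ⊢L B → S ∣ Γ ++ Δ ⊢L A ⊗ B
  ⊗RL (pass f) g = pass (⊗RL f g)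
  ⊗RL (IL f) g = IL (⊗RL f g)
  ⊗RL (⊗L f) g = ⊗L (⊗RL f g)
  ⊗RL (switch f) g = switch (⊗R f g)

  axL : {A : Fma} → just A ∣ [] ⊢L A
  axL {` X} = switch ax
  axL {I} = IL (switch IR)
  axL {A ⊗ B} = ⊗L (⊗RL axL (pass axL))

  focus : {S : Stp} {Γ : Cxt} {C : Fma} → S ∣ Γ ⊢ C → S ∣ Γ ⊢L C
  focus ax = axL
  focus (pass f) = pass (focus f)
  focus (IL f) = IL (focus f)
  focus IR = switch IR
  focus (⊗L f) = ⊗L (focus f)
  focus (⊗R f g) = ⊗RL (focus f) (focus g)

-- focus only rearranges rules, and every rearrangement it performs is an
-- instance of ≗: ⊗RL commutes ⊗R past the left rules of its first premise
-- (⊗Rpass, ⊗RIL, ⊗R⊗L), and axL η-expands the axiom (axI, ax⊗).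
module Submission where

open import Defs
open import Data.Maybe using (nothing; just)

module _ {Var : Set} where

  embL-⊗RL : {S : Stp {Var}} {Γ Δ : Cxt} {A B : Fma} →
    (f : S ∣ Γ ⊢L A) (g : nothing ∣ Δ ⊢L B) →
    embL (⊗RL f g) ≗ ⊗R (embL f) (embL g)
  embL-⊗RL (pass f)   g = pass (embL-⊗RL f g) ∙ (~ ⊗Rpass)
  embL-⊗RL (IL f)     g = IL (embL-⊗RL f g) ∙ (~ ⊗RIL)
  embL-⊗RL (⊗L f)     g = ⊗L (embL-⊗RL f g) ∙ (~ ⊗R⊗L)
  embL-⊗RL (switch f) g = refl≗

  embL-axL : {A : Fma {Var}} → embL (axL {A = A}) ≗ ax
  embL-axL {` X}   = refl≗
  embL-axL {I}     = ~ axI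
  embL-axL {A ⊗ B} =
    ⊗L (embL-⊗RL axL (pass axL) ∙ ⊗R embL-axL (pass embL-axL)) ∙ (~ ax⊗)

lemma5p6 : {Var : Set} {S : Stp {Var}} {Γ : Cxt {Var}} {C : Fma {Var}} →
    (f : S ∣ Γ ⊢ C) → embL (focus f) ≗ f
lemma5p6 ax       = embL-axL
lemma5p6 (pass f) = pass (lemma5p6 f)
lemma5p6 (IL f)   = IL (lemma5p6 f)
lemma5p6 IR       = refl≗
lemma5p6 (⊗L f)   = ⊗L (lemma5p6 f)
lemma5p6 (⊗R f g) = embL-⊗RL (focus f) (focus g) ∙ ⊗R (lemma5p6 f) (lemma5p6 g)
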